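{- Let $D=(V,A)$ be a DAG, let $G=(V,E)$ be its underlying graph, and let $\preceq$ be the partial order on $V$ defined by $u\preceq v$ iff there exists a directed $u,v$-path in $D$. Then every weak directed intersection representation of $D$ is an intersection representation of the partially ordered graph $(G,\preceq)$, and vice versa. In particular, $\mathrm{wdin}(D)=\mathrm{in}(G,\preceq)$.
   Context: The underlying graph of $D$ has an edge $\{u,v\}$ iff $(u,v)\in A$ or $(v,u)\in A$. A weak directed intersection representation of $D$ is a pair $(U,\varphi)$, $U$ finite, $\varphi(v)\subseteq U$, such that for any two distinct $u,v\in V$: $(u,v)\in A$ iff $\varphi(u)\cap\varphi(v)\neq\emptyset$ and $|\varphi(u)|\le|\varphi(v)|$; $\mathrm{wdin}(D)$ is the minimum $|U|$. A partially ordered graph is a pair $(G,\preceq)$ with $G=(V,E)$ a graph and $\preceq$ a partial order on $V$; write $u\prec v$ if $u\preceq v$ and $u\ne v$. An intersection representation of $(G,\preceq)$ is a pair $(U,\varphi)$, $\varphi(v)\subseteq U$, such that for distinct $u,v$: $\{u,v\}\in E$ iff $\varphi(u)\cap\varphi(v)\neq\emptyset$, and if $u\prec v$ then $|\varphi(u)|<|\varphi(v)|$. $\mathrm{in}(G,\preceq)$ is the minimum $|U|$ of such a representation. -}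

module Defs where

open import Data.Nat using (ℕ; _≤_; _<_)
open import Data.Fin using (Fin)
open import Data.Fin.Subset using (Subset; _∈_; ∣_∣)
open import Data.Product using (Σ; ∃; _×_)
open import Data.Sum using (_⊎_)
open import Data.Empty using (⊥)
open import Relation.Nullary using (¬_)
open import Relation.Binary.PropositionalEquality using (_≡_; _≢_)
open import Relation.Binary.Construct.Closure.ReflexiveTransitive using (Star)
open import Relation.Binary.Construct.Closure.Transitive using (TransClosure)
open import Function.Bundles using (_⇔_)

Digraph : ℕ → Set₁
Digraph n = Fin n → Fin n → Set

IsDAG : ∀ {n} → Digraph n → Set
IsDAG A = ∀ v → ¬ TransClosure A v v

Underlying : ∀ {n} → Digraph n → Fin n → Fin n → Set
Underlying A u v = A u v ⊎ A v u

Reach : ∀ {n} → Digraph n → Fin n → Fin n → Set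
Reach A = Star A

StrictOf : ∀ {n} → (Fin n → Fin n → Set) → Fin n → Fin n → Set
StrictOf R u v = R u v × u ≢ v

Meets : ∀ {m} → Subset m → Subset m → Set
Meets X Y = ∃ λ x → x ∈ X × x ∈ Y

IsWDIRep : ∀ {n} → Digraph n → (m : ℕ) → (Fin n → Subset m) → Set
IsWDIRep A m φ = ∀ u v → u ≢ v → A u v ⇔ (Meets (φ u) (φ v) × ∣ φ u ∣ ≤ ∣ φ v ∣)

IsIRep : ∀ {n} → (E P : Fin n → Fin n → Set) → (m : ℕ) → (Fin n → Subset m) → Set
IsIRep E P m φ =
  (∀ u v → u ≢ v → E u v ⇔ Meets (φ u) (φ v)) ×
  (∀ u v → StrictOf P u v → ∣ φ u ∣ < ∣ φ v ∣)

IsMinRepSize : ∀ {n} → ((m : ℕ) → (Fin n → Subset m) → Set) → ℕ → Set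
IsMinRepSize Rep k = (∃ λ φ → Rep k φ) × (∀ m φ → Rep m φ → k ≤ m)

IsWdin : ∀ {n} → Digraph n → ℕ → Set
IsWdin A = IsMinRepSize (IsWDIRep A)

IsIn : ∀ {n} → (E P : Fin n → Fin n → Set) → ℕ → Set
IsIn E P = IsMinRepSize (IsIRep E P)

{-# OPTIONS --safe #-}
-- In a weak directed intersection representation of a DAG, an arc u → v with
-- |φ u| = |φ v| would force the reverse arc v → u and close a 2-cycle, so every
-- arc, and hence every nontrivial directed path, strictly increases |φ|.
-- Conversely, once sizes strictly increase along arcs, comparing |φ u| with
-- |φ v| recovers the orientation of every edge of the underlying graph.
module Submission where

open import Defs
open import Data.Nat using (ℕ; _≤_; _<_)
open import Data.Nat.Properties using (≤-total; ≤-reflexive; <⇒≤; <⇒≱; <-trans; m≤n⇒m<n∨m≡n)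
open import Data.Fin using (Fin)
open import Data.Fin.Subset using (Subset; ∣_∣)
open import Data.Product using (_×_; _,_; proj₁)
open import Data.Sum using (_⊎_; inj₁; inj₂)
open import Data.Empty using (⊥-elim)
open import Function.Bundles using (_⇔_; mk⇔; Equivalence)
open import Relation.Binary.Core using (Rel; _=[_]⇒_)
open import Relation.Binary.PropositionalEquality using (_≡_; _≢_; refl; sym; ≢-sym)
open import Relation.Binary.Construct.Closure.ReflexiveTransitive using (Star; ε; _◅_)
open import Relation.Binary.Construct.Closure.Transitive using ([_]; _∷_)
import Function.Properties.Equivalence as ⇔

open Equivalence using (to; from)

meets-sym : ∀ {m} {X Y : Subset m} → Meets X Y → Meets Y X
meets-sym (x , x∈X , x∈Y) = x , x∈Y , x∈X

star-strictMono : ∀ {a ℓ} {X : Set a} {R : Rel X ℓ} (f : X → ℕ) →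
  R =[ f ]⇒ _<_ → ∀ {u v} → Star R u v → u ≡ v ⊎ f u < f v
star-strictMono f mono ε = inj₁ refl
star-strictMono f mono (r ◅ p) with star-strictMono f mono p
... | inj₁ refl = inj₂ (mono r)
... | inj₂ lt   = inj₂ (<-trans (mono r) lt)

RepPredicate : ℕ → Set₁
RepPredicate n = (m : ℕ) → (Fin n → Subset m) → Set

isMinRepSize-transport : ∀ {n} {Rep₁ Rep₂ : RepPredicate n} →
  (∀ m φ → Rep₁ m φ ⇔ Rep₂ m φ) → ∀ {k} → IsMinRepSize Rep₁ k → IsMinRepSize Rep₂ k
isMinRepSize-transport Rep₁⇔Rep₂ ((φ , rep) , minimal) =
  (φ , to (Rep₁⇔Rep₂ _ φ) rep) , λ m ψ rep₂ → minimal m ψ (from (Rep₁⇔Rep₂ m ψ) rep₂)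

isMinRepSize-cong : ∀ {n} {Rep₁ Rep₂ : RepPredicate n} →
  (∀ m φ → Rep₁ m φ ⇔ Rep₂ m φ) → ∀ k → IsMinRepSize Rep₁ k ⇔ IsMinRepSize Rep₂ k
isMinRepSize-cong Rep₁⇔Rep₂ k = mk⇔
  (isMinRepSize-transport Rep₁⇔Rep₂)
  (isMinRepSize-transport (λ m φ → ⇔.sym (Rep₁⇔Rep₂ m φ)))

module _ {n} (A : Digraph n) {m} {φ : Fin n → Subset m} where

  wdiRep-underlying⇔meets : IsWDIRep A m φ →
    ∀ u v → u ≢ v → Underlying A u v ⇔ Meets (φ u) (φ v)
  wdiRep-underlying⇔meets rep u v u≢v = mk⇔ edge⇒meets meets⇒edge
    where
    edge⇒meets : Underlying A u v → Meets (φ u) (φ v)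
    edge⇒meets (inj₁ uv) = proj₁ (to (rep u v u≢v) uv)
    edge⇒meets (inj₂ vu) = meets-sym (proj₁ (to (rep v u (≢-sym u≢v)) vu))

    meets⇒edge : Meets (φ u) (φ v) → Underlying A u v
    meets⇒edge meets with ≤-total ∣ φ u ∣ ∣ φ v ∣
    ... | inj₁ u≤v = inj₁ (from (rep u v u≢v) (meets , u≤v))
    ... | inj₂ v≤u = inj₂ (from (rep v u (≢-sym u≢v)) (meets-sym meets , v≤u))

  iRep⇒wdiRep : IsIRep (Underlying A) (Reach A) m φ → IsWDIRep A m φ
  iRep⇒wdiRep (edges , order) u v u≢v = mk⇔ arc⇒meets meets⇒arc
    where
    arc⇒meets : A u v → Meets (φ u) (φ v) × ∣ φ u ∣ ≤ ∣ φ v ∣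
    arc⇒meets uv = to (edges u v u≢v) (inj₁ uv) , <⇒≤ (order u v (uv ◅ ε , u≢v))

    meets⇒arc : Meets (φ u) (φ v) × ∣ φ u ∣ ≤ ∣ φ v ∣ → A u v
    meets⇒arc (meets , u≤v) with from (edges u v u≢v) meets
    ... | inj₁ uv = uv
    ... | inj₂ vu = ⊥-elim (<⇒≱ (order v u (vu ◅ ε , ≢-sym u≢v)) u≤v)

module _ {n} {A : Digraph n} (dag : IsDAG A) where

  dag-arc⇒≢ : ∀ {u v} → A u v → u ≢ v
  dag-arc⇒≢ uv refl = dag _ [ uv ]

  module _ {m} {φ : Fin n → Subset m} (rep : IsWDIRep A m φ) where

    dag-wdiRep-arc⇒< : ∀ {u v} → A u v → ∣ φ u ∣ < ∣ φ v ∣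
    dag-wdiRep-arc⇒< {u} {v} uv with to (rep u v (dag-arc⇒≢ uv)) uv
    ... | meets , u≤v with m≤n⇒m<n∨m≡n u≤v
    ...   | inj₁ u<v = u<v
    ...   | inj₂ u≡v = ⊥-elim (dag u (uv ∷ [ vu ]))
      where
      vu : A v u
      vu = from (rep v u (≢-sym (dag-arc⇒≢ uv))) (meets-sym meets , ≤-reflexive (sym u≡v))

    dag-wdiRep-reach⇒< : ∀ u v → StrictOf (Reach A) u v → ∣ φ u ∣ < ∣ φ v ∣
    dag-wdiRep-reach⇒< u v (path , u≢v) with star-strictMono (λ w → ∣ φ w ∣) dag-wdiRep-arc⇒< path
    ... | inj₁ u≡v = ⊥-elim (u≢v u≡v)
    ... | inj₂ u<v = u<v

    dag-wdiRep⇒iRep : IsIRep (Underlying A) (Reach A) m φ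
    dag-wdiRep⇒iRep = wdiRep-underlying⇔meets A rep , dag-wdiRep-reach⇒<

lemma7 : ∀ {n} (A : Digraph n) → IsDAG A →
    ((m : ℕ) (φ : Fin n → Subset m) →
      IsWDIRep A m φ ⇔ IsIRep (Underlying A) (Reach A) m φ)
    × ((k : ℕ) → IsWdin A k ⇔ IsIn (Underlying A) (Reach A) k)
lemma7 {n} A dag = wdiRep⇔iRep , isMinRepSize-cong wdiRep⇔iRep
  where
  wdiRep⇔iRep : (m : ℕ) (φ : Fin n → Subset m) → IsWDIRep A m φ ⇔ IsIRep (Underlying A) (Reach A) m φ
  wdiRep⇔iRep m φ = mk⇔ (dag-wdiRep⇒iRep dag) (iRep⇒wdiRep A)
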